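{- Let $G$ be a $3$-non-compliant graph on $14$ vertices, and let $u,v\in V(G)$ be adjacent vertices with $\deg_G(u)=\deg_G(v)=7$. Then $|N_G(u)\cap N_G(v)|\ge 3$.
   Context: All graphs are finite, simple and undirected; $\overline{G}$ denotes the complement of $G$; $N_G(u)$ is the set of vertices adjacent to $u$. A minor of $G$ is a graph obtained from $G$ by a sequence of vertex deletions, edge deletions and edge contractions. $\Delta(H)$ is the maximum degree of $H$. A graph $G$ on $n$ vertices is $3$-non-compliant if neither $G$ nor $\overline{G}$ has a minor $H$ with $\Delta(H)\ge n-3$. -}

module Defs where

open import Data.Bool using (Bool; true; false; not; _∧_; _∨_; if_then_else_)
open import Data.Bool.Properties using (∨-comm; ∨-assoc; ∧-comm)
open import Data.Nat using (ℕ; suc; _≤_; _∸_)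
open import Data.Fin using (Fin; punchIn)
open import Data.Fin.Properties using (_≟_)
open import Data.Fin.Subset using (Subset; ∣_∣; _∩_)
open import Data.Vec using (tabulate)
open import Data.Product using (Σ; _×_; _,_)
open import Relation.Nullary using (¬_; yes; no)
open import Relation.Nullary.Decidable using (⌊_⌋)
open import Relation.Binary.PropositionalEquality using (_≡_; refl; sym; cong; cong₂; trans)

record Graph (n : ℕ) : Set where
  field
    adj    : Fin n → Fin n → Bool
    adj-sym    : ∀ a b → adj a b ≡ adj b a
    adj-irrefl : ∀ a → adj a a ≡ false
open Graph public

_==_ : ∀ {n} → Fin n → Fin n → Bool
a == b = ⌊ a ≟ b ⌋

==-sym : ∀ {n} (a b : Fin n) → (a == b) ≡ (b == a)
==-sym a b with a ≟ b | b ≟ a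
... | yes _ | yes _ = refl
... | no _  | no _  = refl
... | yes p | no q  = Data.Empty.⊥-elim (q (sym p)) where import Data.Empty
... | no p  | yes q = Data.Empty.⊥-elim (p (sym q)) where import Data.Empty

==-refl : ∀ {n} (a : Fin n) → (a == a) ≡ true
==-refl a with a ≟ a
... | yes _ = refl
... | no q  = Data.Empty.⊥-elim (q refl) where import Data.Empty

N : ∀ {n} → Graph n → Fin n → Subset n
N G u = tabulate (adj G u)

deg : ∀ {n} → Graph n → Fin n → ℕ
deg G u = ∣ N G u ∣

complement : ∀ {n} → Graph n → Graph n
complement G = record
  { adj = λ a b → not (a == b) ∧ not (adj G a b)
  ; adj-sym = λ a b → cong₂ (λ x y → not x ∧ not y) (==-sym a b) (adj-sym G a b)
  ; adj-irrefl = λ a → cong (λ x → not x ∧ not (adj G a a)) (==-refl a)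
  }

deleteVertex : ∀ {n} → Graph (suc n) → Fin (suc n) → Graph n
deleteVertex G i = record
  { adj = λ a b → adj G (punchIn i a) (punchIn i b)
  ; adj-sym = λ a b → adj-sym G (punchIn i a) (punchIn i b)
  ; adj-irrefl = λ a → adj-irrefl G (punchIn i a)
  }

deleteEdge : ∀ {n} → Graph n → Fin n → Fin n → Graph n
deleteEdge G i j = record
  { adj = λ a b → not (hit a b) ∧ adj G a b
  ; adj-sym = λ a b → cong₂ (λ x y → not x ∧ y) (hit-sym a b) (adj-sym G a b)
  ; adj-irrefl = λ a → trans (cong (not (hit a a) ∧_) (adj-irrefl G a)) (∧-comm (not (hit a a)) false)
  }
  where
  hit : _ → _ → Bool
  hit a b = ((a == i) ∧ (b == j)) ∨ ((a == j) ∧ (b == i))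
  hit-sym : ∀ a b → hit a b ≡ hit b a
  hit-sym a b = trans (∨-comm ((a == i) ∧ (b == j)) ((a == j) ∧ (b == i)))
                      (cong₂ _∨_ (∧-comm (a == j) (b == i)) (∧-comm (a == i) (b == j)))

-- Identify vertex j with vertex i (i keeps N(i) ∪ N(j)); no loops are created.
-- Vertex j still exists afterwards and is removed in `contract`.
merge : ∀ {n} → Graph n → Fin n → Fin n → Graph n
merge G i j = record
  { adj = λ a b → not (a == b) ∧ body a b
  ; adj-sym = λ a b → cong₂ (λ x y → not x ∧ y) (==-sym a b) (body-sym a b)
  ; adj-irrefl = λ a → cong (λ x → not x ∧ body a a) (==-refl a)
  }
  where
  body : _ → _ → Bool
  body a b = adj G a b ∨ (((a == i) ∧ adj G j b) ∨ ((b == i) ∧ adj G a j))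
  body-sym : ∀ a b → body a b ≡ body b a
  body-sym a b = cong₂ _∨_ (adj-sym G a b)
    (trans (∨-comm ((a == i) ∧ adj G j b) ((b == i) ∧ adj G a j))
           (cong₂ (λ x y → ((b == i) ∧ x) ∨ ((a == i) ∧ y)) (adj-sym G a j) (adj-sym G j b)))

contract : ∀ {n} → Graph (suc n) → Fin (suc n) → Fin (suc n) → Graph n
contract G i j = deleteVertex (merge G i j) j

data _≼_ : ∀ {m n} → Graph m → Graph n → Set where
  done  : ∀ {n} {G : Graph n} → G ≼ G
  delV  : ∀ {m n} {H : Graph m} {G : Graph (suc n)} (i : Fin (suc n)) →
          H ≼ deleteVertex G i → H ≼ G
  delE  : ∀ {m n} {H : Graph m} {G : Graph n} (i j : Fin n) →
          adj G i j ≡ true → H ≼ deleteEdge G i j → H ≼ G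
  contr : ∀ {m n} {H : Graph m} {G : Graph (suc n)} (i j : Fin (suc n)) →
          adj G i j ≡ true → H ≼ contract G i j → H ≼ G

HasMinorWithMaxDegAtLeast : ∀ {n} → Graph n → ℕ → Set
HasMinorWithMaxDegAtLeast G k =
  Σ ℕ λ m → Σ (Graph m) λ H → (H ≼ G) × (Σ (Fin m) λ x → k ≤ deg H x)

ThreeNonCompliant : ∀ {n} → Graph n → Set
ThreeNonCompliant {n} G =
  ¬ HasMinorWithMaxDegAtLeast G (n ∸ 3) × ¬ HasMinorWithMaxDegAtLeast (complement G) (n ∸ 3)

{-# OPTIONS --safe #-}
module Submission where

-- Let R be the set of common non-neighbours of u and v. Since deg u + deg v = 14,
-- |R| = |N(u) ∩ N(v)|, so it suffices to show that |R| ≤ 2 is impossible.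
-- If some neighbour x ≠ v of u is adjacent to all of R, then {u, x, v} dominates G
-- and contracting ux and uv leaves a vertex adjacent to all other 11.
-- Otherwise every neighbour of u misses a vertex of R; as |R| ≤ 2 ≤ deg_Ḡ(u) there are
-- r₁ ≠ r₂ in N_Ḡ(u) with R ⊆ {r₁, r₂}, so {u, r₁, r₂} dominates Ḡ and contracting
-- ur₁ and ur₂ in Ḡ does the same.

open import Defs
open import Data.Bool using (true; false)
open import Data.Bool.Properties using (∨-zeroʳ)
open import Data.Empty using (⊥-elim)
open import Data.Fin using (Fin; punchIn; punchOut)
open import Data.Fin.Properties using (_≟_; any?; punchIn-punchOut; punchIn-injective)
open import Data.Fin.Subset
  using (Subset; ∣_∣; ∁; _∪_; _∩_; _─_; _-_; ⁅_⁆; _∈_; _∉_; _⊆_; _⊈_; Nonempty; inside; outside)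
open import Data.Fin.Subset.Properties
  using ( _∈?_; _⊆?_; nonempty?; Empty-unique; ∣⊥∣≡0; ∣⁅x⁆∣≡1; ∣∁p∣≡n∸∣p∣; p⊆q⇒∣p∣≤∣q∣
        ; x∈⁅x⁆; x∉⁅y⁆⇒x≢y; x∈∁p⇒x∉p; x∉∁p⇒x∈p; x∈p∪q⁺; x∈p∪q⁻; p─q⊆p
        ; x∈p∧x≢y⇒x∈p-y; x∈p⇒∣p-x∣<∣p∣ )
open import Data.Nat using (ℕ; suc; _+_; _∸_; _≤_; _<_; z≤n; s≤s; s≤s⁻¹; _≤?_)
open import Data.Nat.Properties
  using (+-suc; m+n∸m≡n; m≤m+n; ≤-trans; ≤-<-trans; <⇒≢; <⇒≱; ≰⇒>; +-cancelˡ-≤)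
open import Data.Product using (∃; ∃₂; _×_; _,_; proj₁; proj₂)
open import Data.Sum using (_⊎_; inj₁; inj₂; [_,_])
open import Data.Vec using ([]; _∷_; here; there)
open import Data.Vec.Properties using (lookup∘tabulate; []=⇒lookup; lookup⇒[]=)
open import Function using (_∘_)
open import Relation.Nullary using (¬_; yes; no; ¬?; _×-dec_)
open import Relation.Nullary.Decidable using (dec-false; isYes≗does; decidable-stable)
open import Relation.Binary.PropositionalEquality
  using (_≡_; _≢_; refl; sym; trans; cong; cong₂; subst; subst₂; module ≡-Reasoning)

private
  variable
    n : ℕ
    p q : Subset n
    w x y z : Fin n

∣p∪q∣+∣p∩q∣≡∣p∣+∣q∣ : ∀ (p q : Subset n) → ∣ p ∪ q ∣ + ∣ p ∩ q ∣ ≡ ∣ p ∣ + ∣ q ∣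
∣p∪q∣+∣p∩q∣≡∣p∣+∣q∣ []            []            = refl
∣p∪q∣+∣p∩q∣≡∣p∣+∣q∣ (inside ∷ p)  (inside ∷ q)  = cong suc (begin
  ∣ p ∪ q ∣ + suc ∣ p ∩ q ∣    ≡⟨ +-suc ∣ p ∪ q ∣ ∣ p ∩ q ∣ ⟩
  suc (∣ p ∪ q ∣ + ∣ p ∩ q ∣)  ≡⟨ cong suc (∣p∪q∣+∣p∩q∣≡∣p∣+∣q∣ p q) ⟩
  suc (∣ p ∣ + ∣ q ∣)          ≡⟨ +-suc ∣ p ∣ ∣ q ∣ ⟨
  ∣ p ∣ + suc ∣ q ∣            ∎)
  where open ≡-Reasoning
∣p∪q∣+∣p∩q∣≡∣p∣+∣q∣ (inside ∷ p)  (outside ∷ q) = cong suc (∣p∪q∣+∣p∩q∣≡∣p∣+∣q∣ p q)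
∣p∪q∣+∣p∩q∣≡∣p∣+∣q∣ (outside ∷ p) (inside ∷ q)  =
  trans (cong suc (∣p∪q∣+∣p∩q∣≡∣p∣+∣q∣ p q)) (sym (+-suc ∣ p ∣ ∣ q ∣))
∣p∪q∣+∣p∩q∣≡∣p∣+∣q∣ (outside ∷ p) (outside ∷ q) = ∣p∪q∣+∣p∩q∣≡∣p∣+∣q∣ p q

∣p∪q∣≤∣p∣+∣q∣ : ∀ (p q : Subset n) → ∣ p ∪ q ∣ ≤ ∣ p ∣ + ∣ q ∣
∣p∪q∣≤∣p∣+∣q∣ p q = subst (∣ p ∪ q ∣ ≤_) (∣p∪q∣+∣p∩q∣≡∣p∣+∣q∣ p q) (m≤m+n ∣ p ∪ q ∣ ∣ p ∩ q ∣)

∣∁[p∪q]∣≡∣p∩q∣ : ∀ (p q : Subset n) → ∣ p ∣ + ∣ q ∣ ≡ n → ∣ ∁ (p ∪ q) ∣ ≡ ∣ p ∩ q ∣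
∣∁[p∪q]∣≡∣p∩q∣ {n} p q ∣p∣+∣q∣≡n = begin
  ∣ ∁ (p ∪ q) ∣                      ≡⟨ ∣∁p∣≡n∸∣p∣ (p ∪ q) ⟩
  n ∸ ∣ p ∪ q ∣                      ≡⟨ cong (_∸ ∣ p ∪ q ∣) ∣p∣+∣q∣≡n ⟨
  ∣ p ∣ + ∣ q ∣ ∸ ∣ p ∪ q ∣          ≡⟨ cong (_∸ ∣ p ∪ q ∣) (∣p∪q∣+∣p∩q∣≡∣p∣+∣q∣ p q) ⟨
  ∣ p ∪ q ∣ + ∣ p ∩ q ∣ ∸ ∣ p ∪ q ∣  ≡⟨ m+n∸m≡n ∣ p ∪ q ∣ ∣ p ∩ q ∣ ⟩
  ∣ p ∩ q ∣                          ∎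
  where open ≡-Reasoning

∣∁⁅x⁆∣≡n : (x : Fin (suc n)) → ∣ ∁ ⁅ x ⁆ ∣ ≡ n
∣∁⁅x⁆∣≡n {n} x = trans (∣∁p∣≡n∸∣p∣ ⁅ x ⁆) (cong (suc n ∸_) (∣⁅x⁆∣≡1 x))

y∈∁⁅x⁆⇒x≢y : y ∈ ∁ ⁅ x ⁆ → x ≢ y
y∈∁⁅x⁆⇒x≢y y∈∁⁅x⁆ refl = x∈∁p⇒x∉p y∈∁⁅x⁆ (x∈⁅x⁆ _)

x∈p─q⇒x∉q : ∀ (p q : Subset n) → x ∈ p ─ q → x ∉ q
x∈p─q⇒x∉q (_ ∷ p) (_ ∷ q) (there x∈p─q) (there x∈q) = x∈p─q⇒x∉q p q x∈p─q x∈q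
x∈p─q⇒x∉q (_ ∷ _) (_ ∷ _) () here

∣p∣≤1+∣p-x∣ : ∀ (p : Subset n) x → ∣ p ∣ ≤ 1 + ∣ p - x ∣
∣p∣≤1+∣p-x∣ p x = ≤-trans (p⊆q⇒∣p∣≤∣q∣ p⊆⁅x⁆∪p-x)
  (subst (λ k → ∣ ⁅ x ⁆ ∪ (p - x) ∣ ≤ k + ∣ p - x ∣) (∣⁅x⁆∣≡1 x) (∣p∪q∣≤∣p∣+∣q∣ ⁅ x ⁆ (p - x)))
  where
  p⊆⁅x⁆∪p-x : p ⊆ ⁅ x ⁆ ∪ (p - x)
  p⊆⁅x⁆∪p-x {y} y∈p with y ≟ x
  ... | yes refl = x∈p∪q⁺ (inj₁ (x∈⁅x⁆ y))
  ... | no y≢x   = x∈p∪q⁺ (inj₂ (x∈p∧x≢y⇒x∈p-y y∈p y≢x))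

0<∣p∣⇒Nonempty : 0 < ∣ p ∣ → Nonempty p
0<∣p∣⇒Nonempty {n} {p} 0<∣p∣ with nonempty? p
... | yes nonempty = nonempty
... | no  empty    = ⊥-elim (<⇒≢ 0<∣p∣ (sym (trans (cong ∣_∣ (Empty-unique empty)) (∣⊥∣≡0 n))))

2≤∣p∣⇒∃-other : 2 ≤ ∣ p ∣ → ∀ x → ∃ λ y → y ∈ p × y ≢ x
2≤∣p∣⇒∃-other {p = p} 2≤∣p∣ x with 0<∣p∣⇒Nonempty (s≤s⁻¹ (≤-trans 2≤∣p∣ (∣p∣≤1+∣p-x∣ p x)))
... | y , y∈p-x = y , p─q⊆p p ⁅ x ⁆ y∈p-x , x∉⁅y⁆⇒x≢y (x∈p─q⇒x∉q p ⁅ x ⁆ y∈p-x)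

2≤∣p∣⇒∃-pair : 2 ≤ ∣ p ∣ → ∃₂ λ x y → x ≢ y × x ∈ p × y ∈ p
2≤∣p∣⇒∃-pair 2≤∣p∣ with 0<∣p∣⇒Nonempty (≤-trans (s≤s z≤n) 2≤∣p∣)
... | x , x∈p with 2≤∣p∣⇒∃-other 2≤∣p∣ x
...   | y , y∈p , y≢x = x , y , y≢x ∘ sym , x∈p , y∈p

three-distinct⇒3≤∣p∣ : x ∈ p → y ∈ p → z ∈ p → x ≢ y → x ≢ z → y ≢ z → 3 ≤ ∣ p ∣
three-distinct⇒3≤∣p∣ x∈p y∈p z∈p x≢y x≢z y≢z =
  ≤-<-trans (≤-<-trans (≤-<-trans z≤n (x∈p⇒∣p-x∣<∣p∣ z∈p-x-y)) (x∈p⇒∣p-x∣<∣p∣ y∈p-x))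
            (x∈p⇒∣p-x∣<∣p∣ x∈p)
  where
  y∈p-x = x∈p∧x≢y⇒x∈p-y y∈p (x≢y ∘ sym)
  z∈p-x-y = x∈p∧x≢y⇒x∈p-y (x∈p∧x≢y⇒x∈p-y z∈p (x≢z ∘ sym)) (y≢z ∘ sym)

pair-cover : p ⊆ q → ∣ p ∣ ≤ 2 → 2 ≤ ∣ q ∣ →
             ∃₂ λ x y → x ≢ y × x ∈ q × y ∈ q × (∀ {z} → z ∈ p → z ≡ x ⊎ z ≡ y)
pair-cover {p = p} p⊆q ∣p∣≤2 2≤∣q∣ with nonempty? p
... | no empty with 2≤∣p∣⇒∃-pair 2≤∣q∣
...   | x , y , x≢y , x∈q , y∈q = x , y , x≢y , x∈q , y∈q , λ z∈p → ⊥-elim (empty (_ , z∈p))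
pair-cover {p = p} p⊆q ∣p∣≤2 2≤∣q∣ | yes (x , x∈p) with nonempty? (p - x)
...   | yes (y , y∈p-x) = x , y , x≢y , p⊆q x∈p , p⊆q y∈p , cover
  where
  y∈p = p─q⊆p p ⁅ x ⁆ y∈p-x
  x≢y = x∉⁅y⁆⇒x≢y (x∈p─q⇒x∉q p ⁅ x ⁆ y∈p-x) ∘ sym
  cover : ∀ {z} → z ∈ p → z ≡ x ⊎ z ≡ y
  cover {z} z∈p with z ≟ x | z ≟ y
  ... | yes z≡x | _       = inj₁ z≡x
  ... | no _    | yes z≡y = inj₂ z≡y
  ... | no z≢x  | no z≢y  =
    ⊥-elim (<⇒≱ (three-distinct⇒3≤∣p∣ x∈p y∈p z∈p x≢y (z≢x ∘ sym) (z≢y ∘ sym)) ∣p∣≤2)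
...   | no only-x with 2≤∣p∣⇒∃-other 2≤∣q∣ x
...     | y , y∈q , y≢x = x , y , y≢x ∘ sym , p⊆q x∈p , y∈q , cover
  where
  cover : ∀ {z} → z ∈ p → z ≡ x ⊎ z ≡ y
  cover {z} z∈p with z ≟ x
  ... | yes z≡x = inj₁ z≡x
  ... | no z≢x  = ⊥-elim (only-x (z , x∈p∧x≢y⇒x∈p-y z∈p z≢x))

⊈⇒∃∉ : p ⊈ q → ∃ λ x → x ∈ p × x ∉ q
⊈⇒∃∉ {p = p} {q} p⊈q with any? (λ x → x ∈? p ×-dec ¬? (x ∈? q))
... | yes witness = witness
... | no  none    =
  ⊥-elim (p⊈q λ {x} x∈p → decidable-stable (x ∈? q) (λ x∉q → none (x , x∈p , x∉q)))

≢⇒==false : x ≢ y → (x == y) ≡ false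
≢⇒==false {x = x} {y} x≢y = trans (isYes≗does (x ≟ y)) (dec-false (x ≟ y) x≢y)

module _ (G : Graph n) where

  adj⇒≢ : adj G x y ≡ true → x ≢ y
  adj⇒≢ {x} xy refl with () ← trans (sym xy) (adj-irrefl G x)

  adj-symm : adj G x y ≡ true → adj G y x ≡ true
  adj-symm {x} {y} xy = trans (adj-sym G y x) xy

  ∈N⇒adj : x ∈ N G y → adj G y x ≡ true
  ∈N⇒adj {x} {y} x∈N = trans (sym (lookup∘tabulate (adj G y) x)) ([]=⇒lookup x∈N)

  adj⇒∈N : adj G y x ≡ true → x ∈ N G y
  adj⇒∈N {y} {x} yx = lookup⇒[]= x (N G y) (trans (lookup∘tabulate (adj G y) x) yx)

  ∉N⇒adjᶜ : x ≢ y → y ∉ N G x → adj (complement G) x y ≡ true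
  ∉N⇒adjᶜ {x} {y} x≢y y∉N rewrite ≢⇒==false x≢y with adj G x y in xy
  ... | false = refl
  ... | true  = ⊥-elim (y∉N (adj⇒∈N xy))

  merge-keeps : ∀ i j → adj G x y ≡ true → adj (merge G i j) x y ≡ true
  merge-keeps i j xy rewrite ≢⇒==false (adj⇒≢ xy) | xy = refl

  merge-absorbs : ∀ i j → i ≢ y → adj G i y ≡ true ⊎ adj G j y ≡ true →
                  adj (merge G i j) i y ≡ true
  merge-absorbs i j _ (inj₁ iy) = merge-keeps i j iy
  merge-absorbs {y} i j i≢y (inj₂ jy)
    rewrite ≢⇒==false i≢y | ==-refl i | jy = ∨-zeroʳ (adj G i y)

universal⇒deg : (G : Graph (suc n)) (x : Fin (suc n)) →
                (∀ y → x ≢ y → adj G x y ≡ true) → n ≤ deg G x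
universal⇒deg G x universal =
  subst (_≤ deg G x) (∣∁⁅x⁆∣≡n x)
        (p⊆q⇒∣p∣≤∣q∣ (λ {y} y∈∁⁅x⁆ → adj⇒∈N G (universal y (y∈∁⁅x⁆⇒x≢y y∈∁⁅x⁆))))

n≤deg+degᶜ : (G : Graph (suc n)) (x : Fin (suc n)) → n ≤ deg G x + deg (complement G) x
n≤deg+degᶜ G x =
  subst (_≤ deg G x + deg (complement G) x) (∣∁⁅x⁆∣≡n x)
        (≤-trans (p⊆q⇒∣p∣≤∣q∣ others⊆N∪Nᶜ) (∣p∪q∣≤∣p∣+∣q∣ (N G x) (N (complement G) x)))
  where
  others⊆N∪Nᶜ : ∁ ⁅ x ⁆ ⊆ N G x ∪ N (complement G) x
  others⊆N∪Nᶜ {y} y∈∁⁅x⁆ with y ∈? N G x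
  ... | yes y∈N = x∈p∪q⁺ (inj₁ y∈N)
  ... | no  y∉N = x∈p∪q⁺ (inj₂ (adj⇒∈N (complement G) (∉N⇒adjᶜ G (y∈∁⁅x⁆⇒x≢y y∈∁⁅x⁆) y∉N)))

punchOut≢⇒≢punchIn : {i j : Fin (suc n)} (j≢i : j ≢ i) {y : Fin n} →
                     punchOut j≢i ≢ y → i ≢ punchIn j y
punchOut≢⇒≢punchIn {j = j} j≢i i′≢y i≡ =
  i′≢y (punchIn-injective j _ _ (trans (punchIn-punchOut j≢i) i≡))

-- In contract G i j the merged vertex is punchOut j≢i, and y : Fin n is the old vertex punchIn j y.
module _ (G : Graph (suc n)) (i j : Fin (suc n)) where

  contract-keeps : adj G (punchIn j x) (punchIn j y) ≡ true → adj (contract G i j) x y ≡ true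
  contract-keeps = merge-keeps G i j

  contract-absorbs : (j≢i : j ≢ i) → punchOut j≢i ≢ y →
                     adj G i (punchIn j y) ≡ true ⊎ adj G j (punchIn j y) ≡ true →
                     adj (contract G i j) (punchOut j≢i) y ≡ true
  contract-absorbs {y} j≢i i′≢y i∨j =
    subst (λ x → adj (merge G i j) x (punchIn j y) ≡ true) (sym (punchIn-punchOut j≢i))
          (merge-absorbs G i j (punchOut≢⇒≢punchIn j≢i i′≢y) i∨j)

  contract-dominating-edge : (j≢i : j ≢ i) →
    (∀ z → i ≢ z → adj G i z ≡ true ⊎ adj G j z ≡ true) →
    ∀ y → punchOut j≢i ≢ y → adj (contract G i j) (punchOut j≢i) y ≡ true
  contract-dominating-edge j≢i dominating y i′≢y =
    contract-absorbs j≢i i′≢y (dominating (punchIn j y) (punchOut≢⇒≢punchIn j≢i i′≢y))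

dominating-cherry⇒minor : (G : Graph (3 + n)) {a b c : Fin (3 + n)} →
  adj G a b ≡ true → adj G a c ≡ true → b ≢ c →
  (∀ z → a ≢ z → adj G a z ≡ true ⊎ adj G b z ≡ true ⊎ adj G c z ≡ true) →
  HasMinorWithMaxDegAtLeast G n
dominating-cherry⇒minor {n} G {a} {b} {c} ab ac b≢c dominating =
  suc n , contract G₁ a₁ c₁ , contr a b ab (contr a₁ c₁ a₁c₁ done) ,
  a₂ , universal⇒deg (contract G₁ a₁ c₁) a₂ (contract-dominating-edge G₁ a₁ c₁ c₁≢a₁ dominating₁)
  where
  b≢a : b ≢ a
  b≢a = adj⇒≢ G ab ∘ sym
  G₁ = contract G a b
  a₁ = punchOut b≢a
  c₁ = punchOut b≢c
  a₁c₁ : adj G₁ a₁ c₁ ≡ true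
  a₁c₁ = contract-keeps G a b
    (subst₂ (λ x y → adj G x y ≡ true) (sym (punchIn-punchOut b≢a)) (sym (punchIn-punchOut b≢c)) ac)
  c₁≢a₁ : c₁ ≢ a₁
  c₁≢a₁ = adj⇒≢ G₁ a₁c₁ ∘ sym
  a₂ = punchOut c₁≢a₁
  dominating₁ : ∀ y → a₁ ≢ y → adj G₁ a₁ y ≡ true ⊎ adj G₁ c₁ y ≡ true
  dominating₁ y a₁≢y with dominating (punchIn b y) (punchOut≢⇒≢punchIn b≢a a₁≢y)
  ... | inj₁ ay        = inj₁ (contract-absorbs G a b b≢a a₁≢y (inj₁ ay))
  ... | inj₂ (inj₁ by) = inj₁ (contract-absorbs G a b b≢a a₁≢y (inj₂ by))
  ... | inj₂ (inj₂ cy) = inj₂ (contract-keeps G a b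
          (subst (λ x → adj G x (punchIn b y) ≡ true) (sym (punchIn-punchOut b≢c)) cy))

commonNonNeighbours : Graph n → Fin n → Fin n → Subset n
commonNonNeighbours G u v = ∁ (N G u ∪ N G v)

module _ (G : Graph n) (u v : Fin n) where

  ∈commonNonNeighbours⁻ : w ∈ commonNonNeighbours G u v → w ∉ N G u × w ∉ N G v
  ∈commonNonNeighbours⁻ w∈R =
    (x∈∁p⇒x∉p w∈R ∘ x∈p∪q⁺ ∘ inj₁) , (x∈∁p⇒x∉p w∈R ∘ x∈p∪q⁺ ∘ inj₂)

  ∉commonNonNeighbours⁻ : w ∉ commonNonNeighbours G u v → w ∈ N G u ⊎ w ∈ N G v
  ∉commonNonNeighbours⁻ w∉R = x∈p∪q⁻ (N G u) (N G v) (x∉∁p⇒x∈p w∉R)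

  commonNonNeighbours⊆Nᶜ : adj G u v ≡ true → commonNonNeighbours G u v ⊆ N (complement G) u
  commonNonNeighbours⊆Nᶜ uv {w} w∈R = adj⇒∈N (complement G) (∉N⇒adjᶜ G u≢w w∉Nu)
    where
    w∉Nu = proj₁ (∈commonNonNeighbours⁻ w∈R)
    u≢w : u ≢ w
    u≢w refl = proj₂ (∈commonNonNeighbours⁻ w∈R) (adj⇒∈N G (adj-symm G uv))

cherry-through-neighbour : (G : Graph (3 + n)) {u v x : Fin (3 + n)} →
  adj G u v ≡ true → x ∈ N G u → x ≢ v → commonNonNeighbours G u v ⊆ N G x →
  HasMinorWithMaxDegAtLeast G n
cherry-through-neighbour G {u} {v} {x} uv x∈Nu x≢v R⊆Nx =
  dominating-cherry⇒minor G (∈N⇒adj G x∈Nu) uv x≢v dominating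
  where
  dominating : ∀ z → u ≢ z → adj G u z ≡ true ⊎ adj G x z ≡ true ⊎ adj G v z ≡ true
  dominating z _ with z ∈? commonNonNeighbours G u v
  ... | yes z∈R = inj₂ (inj₁ (∈N⇒adj G (R⊆Nx z∈R)))
  ... | no  z∉R with ∉commonNonNeighbours⁻ G u v z∉R
  ...   | inj₁ z∈Nu = inj₁ (∈N⇒adj G z∈Nu)
  ...   | inj₂ z∈Nv = inj₂ (inj₂ (∈N⇒adj G z∈Nv))

cherry-in-complement : (G : Graph (3 + n)) {u v : Fin (3 + n)} →
  adj G u v ≡ true → 2 ≤ deg (complement G) u → ∣ commonNonNeighbours G u v ∣ ≤ 2 →
  (∀ {x} → x ∈ N G u → ∃ λ w → w ∈ commonNonNeighbours G u v × w ∉ N G x) →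
  HasMinorWithMaxDegAtLeast (complement G) n
cherry-in-complement G {u} {v} uv 2≤degᶜ ∣R∣≤2 missed
  with pair-cover (commonNonNeighbours⊆Nᶜ G u v uv) ∣R∣≤2 2≤degᶜ
... | r₁ , r₂ , r₁≢r₂ , r₁∈Nᶜu , r₂∈Nᶜu , R⊆r₁r₂ =
  dominating-cherry⇒minor Gᶜ (∈N⇒adj Gᶜ r₁∈Nᶜu) (∈N⇒adj Gᶜ r₂∈Nᶜu) r₁≢r₂ dominating
  where
  Gᶜ = complement G
  missed⇒adjᶜ : x ∈ N G u → w ∈ commonNonNeighbours G u v → w ∉ N G x → adj Gᶜ w x ≡ true
  missed⇒adjᶜ x∈Nu w∈R w∉Nx = adj-symm Gᶜ (∉N⇒adjᶜ G x≢w w∉Nx)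
    where
    x≢w : _ ≢ _
    x≢w refl = proj₁ (∈commonNonNeighbours⁻ G u v w∈R) x∈Nu
  dominating : ∀ z → u ≢ z → adj Gᶜ u z ≡ true ⊎ adj Gᶜ r₁ z ≡ true ⊎ adj Gᶜ r₂ z ≡ true
  dominating z u≢z with z ∈? N G u
  ... | no  z∉Nu = inj₁ (∉N⇒adjᶜ G u≢z z∉Nu)
  ... | yes z∈Nu with missed z∈Nu
  ...   | w , w∈R , w∉Nz with R⊆r₁r₂ w∈R | missed⇒adjᶜ z∈Nu w∈R w∉Nz
  ...     | inj₁ refl | wz = inj₂ (inj₁ wz)
  ...     | inj₂ refl | wz = inj₂ (inj₂ wz)

few-common-non-neighbours⇒minor : (G : Graph (3 + n)) {u v : Fin (3 + n)} →
  adj G u v ≡ true → 2 ≤ deg G u → 2 ≤ deg (complement G) u →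
  ∣ commonNonNeighbours G u v ∣ ≤ 2 →
  HasMinorWithMaxDegAtLeast G n ⊎ HasMinorWithMaxDegAtLeast (complement G) n
few-common-non-neighbours⇒minor G {u} {v} uv 2≤deg 2≤degᶜ ∣R∣≤2
  with any? (λ x → x ∈? N G u ×-dec ¬? (x ≟ v) ×-dec commonNonNeighbours G u v ⊆? N G x)
... | yes (x , x∈Nu , x≢v , R⊆Nx) = inj₁ (cherry-through-neighbour G uv x∈Nu x≢v R⊆Nx)
... | no  none                    = inj₂ (cherry-in-complement G uv 2≤degᶜ ∣R∣≤2 missed)
  where
  R = commonNonNeighbours G u v
  separated : x ∈ N G u → x ≢ v → ∃ λ w → w ∈ R × w ∉ N G x
  separated x∈Nu x≢v = ⊈⇒∃∉ (λ R⊆Nx → none (_ , x∈Nu , x≢v , R⊆Nx))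
  -- v misses all of R, so for v it suffices that R ≠ ∅, as witnessed by any other neighbour of u.
  missed : x ∈ N G u → ∃ λ w → w ∈ R × w ∉ N G x
  missed {x} x∈Nu with x ≟ v
  ... | no  x≢v = separated x∈Nu x≢v
  ... | yes refl with 2≤∣p∣⇒∃-other 2≤deg v
  ...   | x₀ , x₀∈Nu , x₀≢v with separated x₀∈Nu x₀≢v
  ...     | w , w∈R , _ = w , w∈R , proj₂ (∈commonNonNeighbours⁻ G u v w∈R)

lemma10 : (G : Graph 14) → ThreeNonCompliant G → (u v : Fin 14) →
          adj G u v ≡ true → deg G u ≡ 7 → deg G v ≡ 7 →
          3 ≤ ∣ N G u ∩ N G v ∣
lemma10 G (no-minor , no-co-minor) u v uv du dv =
  decidable-stable (3 ≤? ∣ N G u ∩ N G v ∣) λ 3≰∣∩∣ →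
    [ no-minor , no-co-minor ] (few-common-non-neighbours⇒minor G uv 2≤deg 2≤degᶜ (∣R∣≤2 3≰∣∩∣))
  where
  2≤deg : 2 ≤ deg G u
  2≤deg = subst (2 ≤_) (sym du) (s≤s (s≤s z≤n))
  6≤degᶜ : 6 ≤ deg (complement G) u
  6≤degᶜ = +-cancelˡ-≤ 7 6 _ (subst (λ d → 13 ≤ d + deg (complement G) u) du (n≤deg+degᶜ G u))
  2≤degᶜ : 2 ≤ deg (complement G) u
  2≤degᶜ = ≤-trans (s≤s (s≤s z≤n)) 6≤degᶜ
  ∣R∣≤2 : ¬ 3 ≤ ∣ N G u ∩ N G v ∣ → ∣ commonNonNeighbours G u v ∣ ≤ 2
  ∣R∣≤2 3≰∣∩∣ = subst (_≤ 2) (sym (∣∁[p∪q]∣≡∣p∩q∣ (N G u) (N G v) (cong₂ _+_ du dv)))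
                      (s≤s⁻¹ (≰⇒> 3≰∣∩∣))
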